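{- Let $n\ge 2$ and $\pi\in M_{2n}$. Then each pointer of $\pi$ is compatible with an even number of pointers.
   Context: Pointers: for $\pi\in S_N$ written $[\pi(1)\ \cdots\ \pi(N)]$, entry $k$ has left pointer $(k-1,k)$ and right pointer $(k,k+1)$; the pointer word $W(\pi)$ lists $L(\pi(1))R(\pi(1))\cdots L(\pi(N))R(\pi(N))$ with $(0,1)$ and $(N,N+1)$ removed. Two distinct pointers are compatible (form a valid pointer context) if their occurrences in $W(\pi)$ interleave ($p\ldots q\ldots p\ldots q$ or $q\ldots p\ldots q\ldots p$). Strategic pile: with $X_N=(0\ 1\ \cdots\ N)$, $Y_\pi=(\pi(N)\ \cdots\ \pi(1)\ 0)$ in cycle notation and $C_\pi=Y_\pi\circ X_N$, $\mathrm{SP}(\pi)$ is the set of numbers after $N$ and before $0$ in the cycle of $C_\pi$ containing $0$ and $N$. $\pi\in S_{2n}$ has maximal strategic pile if $|\mathrm{SP}(\pi)|=2n-1$; then $2n$ is immediately followed by $1$, and its contraction is the permutation of $\mathbb Z_{2n-1}$ obtained by deleting the entry $2n$; its pointers are $(p,p+1)$, $p\in\mathbb Z_{2n-1}$, where $(2n-1,1)$ stands for the pointer $(2n-1,2n)$ of the uncontracted permutation, and compatibility is that of the uncontracted permutation. $M_{2n}$ is the set of all such contractions. -}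

module Defs where

open import Data.Nat using (ℕ; zero; suc; _∸_; _<_; _<?_; _≟_; _*_)
open import Data.Nat.Divisibility using (_∣_)
open import Data.Fin using (Fin; toℕ; fromℕ<)
open import Data.Fin.Properties using (any?)
open import Data.Fin.Permutation using (Permutation′; _⟨$⟩ʳ_; _⟨$⟩ˡ_)
open import Data.List using (List; []; _∷_; map; concatMap; filter; takeWhile; upTo; length; lookup)
open import Data.Product using (Σ; _×_; _,_; ∃)
open import Data.Sum using (_⊎_)
open import Relation.Nullary using (Dec; yes; no; ¬_; ¬?)
open import Relation.Nullary.Decidable using (_×-dec_; _⊎-dec_)
open import Relation.Binary.PropositionalEquality using (_≡_; _≢_)

-- π(i) for 1 ≤ i ≤ N (1-based positions, values in 1..N); 0 outside range.
ent : {N : ℕ} → Permutation′ N → ℕ → ℕ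
ent {N} π zero = 0
ent {N} π (suc i) with i <? N
... | yes i<N = suc (toℕ (π ⟨$⟩ʳ fromℕ< i<N))
... | no _ = 0

-- π⁻¹(v) for 1 ≤ v ≤ N (the 1-based position of the value v); 0 outside range.
pos : {N : ℕ} → Permutation′ N → ℕ → ℕ
pos {N} π zero = 0
pos {N} π (suc v) with v <? N
... | yes v<N = suc (toℕ (π ⟨$⟩ˡ fromℕ< v<N))
... | no _ = 0

-- Strategic pile.  Permutations of {0,…,N} are represented as maps ℕ → ℕ
-- (only their values on 0..N matter).

X : ℕ → ℕ → ℕ
X N x with x ≟ N
... | yes _ = 0
... | no _ = suc x

-- Y_π = (π(N) π(N-1) ⋯ π(1) 0) : 0 ↦ π(N), π(j) ↦ π(j-1) (j ≥ 2), π(1) ↦ 0.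
Y : {N : ℕ} → Permutation′ N → ℕ → ℕ
Y {N} π zero = ent π N
Y {N} π (suc v) = ent π (pos π (suc v) ∸ 1)   -- ent π 0 = 0 handles π(1) ↦ 0

C : {N : ℕ} → Permutation′ N → ℕ → ℕ
C {N} π x = Y π (X N x)

iter : (ℕ → ℕ) → ℕ → ℕ → ℕ
iter f zero x = x
iter f (suc k) x = f (iter f k x)

-- SP(π): the numbers strictly after N and before 0 in the cycle of C_π
-- through N, i.e. C(N), C²(N), … up to (excluding) the first 0.
-- (A cycle has at most N+1 elements, so iterates 1..N suffice.)
SP : {N : ℕ} → Permutation′ N → List ℕ
SP {N} π = takeWhile (λ x → ¬? (x ≟ 0)) (map (λ k → iter (C π) (suc k) N) (upTo N))

MaximalSP : (n : ℕ) → Permutation′ (2 * n) → Set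
MaximalSP n π = length (SP π) ≡ 2 * n ∸ 1

-- Pointers.  The pointer (p, p+1) is encoded by the natural number p.
-- L(k) = (k-1,k) ↦ k ∸ 1,  R(k) = (k,k+1) ↦ k.

-- W(π) = L(π(1))R(π(1))⋯L(π(N))R(π(N)) with (0,1) and (N,N+1) removed.
W : {N : ℕ} → Permutation′ N → List ℕ
W {N} π =
  filter (λ p → ¬? (p ≟ 0) ×-dec ¬? (p ≟ N))
         (concatMap (λ i → (ent π (suc i) ∸ 1) ∷ ent π (suc i) ∷ []) (upTo N))

Ordered : List ℕ → ℕ → ℕ → Set
Ordered w p q =
  Σ (Fin (length w)) λ i → Σ (Fin (length w)) λ j →
  Σ (Fin (length w)) λ k → Σ (Fin (length w)) λ l →
    (toℕ i < toℕ j) × (toℕ j < toℕ k) × (toℕ k < toℕ l) ×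
    (lookup w i ≡ p) × (lookup w j ≡ q) × (lookup w k ≡ p) × (lookup w l ≡ q)

ordered? : (w : List ℕ) (p q : ℕ) → Dec (Ordered w p q)
ordered? w p q =
  any? λ i → any? λ j → any? λ k → any? λ l →
    (toℕ i <? toℕ j) ×-dec (toℕ j <? toℕ k) ×-dec (toℕ k <? toℕ l) ×-dec
    (lookup w i ≟ p) ×-dec (lookup w j ≟ q) ×-dec (lookup w k ≟ p) ×-dec (lookup w l ≟ q)

Compatible : {N : ℕ} → Permutation′ N → ℕ → ℕ → Set
Compatible π p q = (p ≢ q) × (Ordered (W π) p q ⊎ Ordered (W π) q p)

compatible? : {N : ℕ} (π : Permutation′ N) (p q : ℕ) → Dec (Compatible π p q)
compatible? π p q = ¬? (p ≟ q) ×-dec (ordered? (W π) p q ⊎-dec ordered? (W π) q p)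

-- Pointers of the contraction of π ∈ S_{2n} (maximal SP): (p,p+1), p ∈ Z_{2n-1},
-- where (2n-1,1) stands for (2n-1,2n); i.e. the pointers p = 1,…,2n-1 of π.
contractionPointers : (n : ℕ) → List ℕ
contractionPointers n = map suc (upTo (2 * n ∸ 1))

numCompatible : (n : ℕ) → Permutation′ (2 * n) → ℕ → ℕ
numCompatible n π p = length (filter (compatible? π p) (contractionPointers n))

-- When SP(π) is maximal, the cycle of C_π through N visits all of 0, …, N, and since C_π is a
-- permutation it closes with C_π(0) = N: the entry N of π is immediately followed by 1. The pair
-- N, 1 contributes the adjacent letters N ∸ 1, N, 0, 1 to L(π(1))R(π(1))⋯L(π(N))R(π(N)), and W(π)
-- only deletes the middle two. Hence every pointer q occurs in W(π) exactly twice, once at an even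
-- position (as L(q + 1)) and once at an odd one (as R(q)), so the gap between the two occurrences
-- of a pointer p has even length. A pointer compatible with p occurs exactly once in that gap and
-- any other pointer 0 or 2 times, so counting the letters of the gap shows that the number of
-- pointers compatible with p is even.
module Submission where

open import Defs
open import Data.Nat using (ℕ; zero; suc; _+_; _∸_; _*_; _≤_; _<_; _≟_; _<?_; _≤?_; z≤n; s≤s; s≤s⁻¹)
open import Data.Nat.Properties
open import Algebra.Properties.CommutativeSemigroup +-commutativeSemigroup
  using () renaming (interchange to +-interchange)
open import Data.Nat.Divisibility using (_∣_; divides; ∣m+n∣m⇒∣n; m∣m*n)
open import Data.Nat.ListAction using (sum)
open import Data.Fin using (Fin; toℕ; fromℕ<) renaming (zero to fzero; suc to fsuc)
open import Data.Fin.Properties using (toℕ<n; toℕ-fromℕ<; fromℕ<-toℕ; pigeonhole)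
open import Data.Fin.Permutation using (Permutation′; _⟨$⟩ʳ_; _⟨$⟩ˡ_; inverseˡ; inverseʳ)
open import Data.Empty using (⊥-elim)
open import Data.Product using (∃; _×_; _,_; proj₁; proj₂)
open import Data.Sum using (_⊎_; inj₁; inj₂) renaming (map to ⊎-map)
open import Data.List
  using (List; []; _∷_; _++_; length; lookup; map; upTo; applyUpTo; take; drop; takeWhile; concatMap; filter)
open import Data.List.Properties
  using (length-++; map-upTo; length-applyUpTo; concatMap-map; concatMap-++;
         filter-++; filter-all; filter-accept; filter-reject)
open import Data.List.Membership.Propositional using (_∈_)
open import Data.List.Relation.Unary.All using (All; []; _∷_)
import Data.List.Relation.Unary.All as All
open import Data.List.Relation.Unary.All.Properties using (++⁺; ++⁻ˡ; ++⁻ʳ; applyUpTo⁺₁)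
open import Function using (_∘_)
open import Relation.Nullary using (yes; no; ¬_; ¬?)
open import Relation.Nullary.Decidable using (_×-dec_; decidable-stable)
open import Relation.Unary using (Decidable)
open import Relation.Binary.PropositionalEquality

-- Indexing and counting in lists of naturals

at : List ℕ → ℕ → ℕ
at []       _       = 0
at (x ∷ xs) zero    = x
at (x ∷ xs) (suc i) = at xs i

at-++ˡ : ∀ xs ys {i} → i < length xs → at (xs ++ ys) i ≡ at xs i
at-++ˡ (x ∷ xs) ys {zero}  _  = refl
at-++ˡ (x ∷ xs) ys {suc i} lt = at-++ˡ xs ys (s≤s⁻¹ lt)

at-++ʳ : ∀ xs ys i → at (xs ++ ys) (length xs + i) ≡ at ys i
at-++ʳ []       ys i = refl
at-++ʳ (x ∷ xs) ys i = at-++ʳ xs ys i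

at-++-∷ : ∀ xs y ys → at (xs ++ y ∷ ys) (length xs) ≡ y
at-++-∷ []       y ys = refl
at-++-∷ (x ∷ xs) y ys = at-++-∷ xs y ys

lookup≡at : ∀ xs (i : Fin (length xs)) → lookup xs i ≡ at xs (toℕ i)
lookup≡at (x ∷ xs) fzero    = refl
lookup≡at (x ∷ xs) (fsuc i) = lookup≡at xs i

δ : ℕ → ℕ → ℕ
δ x y with x ≟ y
... | yes _ = 1
... | no  _ = 0

δ-refl : ∀ x → δ x x ≡ 1
δ-refl x with x ≟ x
... | yes _  = refl
... | no x≢x = ⊥-elim (x≢x refl)

δ-≢ : ∀ {x y} → x ≢ y → δ x y ≡ 0
δ-≢ {x} {y} x≢y with x ≟ y
... | yes x≡y = ⊥-elim (x≢y x≡y)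
... | no  _   = refl

δ-sym : ∀ x y → δ x y ≡ δ y x
δ-sym x y with x ≟ y
... | yes refl = sym (δ-refl x)
... | no  x≢y  = sym (δ-≢ (x≢y ∘ sym))

count : ℕ → List ℕ → ℕ
count x []       = 0
count x (y ∷ ys) = δ x y + count x ys

count-++ : ∀ x xs ys → count x (xs ++ ys) ≡ count x xs + count x ys
count-++ x []       ys = refl
count-++ x (y ∷ xs) ys = trans (cong (δ x y +_) (count-++ x xs ys)) (sym (+-assoc (δ x y) _ _))

at⇒count-pos : ∀ {x} xs {i} → i < length xs → at xs i ≡ x → 0 < count x xs
at⇒count-pos {x} (y ∷ xs) {zero}  _  refl = ≤-trans (≤-reflexive (sym (δ-refl y))) (m≤m+n _ _)
at⇒count-pos {x} (y ∷ xs) {suc i} lt eq = ≤-trans (at⇒count-pos xs (s≤s⁻¹ lt) eq) (m≤n+m _ (δ x y))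

count-pos⇒at : ∀ x xs → 0 < count x xs → ∃ λ i → i < length xs × at xs i ≡ x
count-pos⇒at x (y ∷ xs) pos with x ≟ y
... | yes refl = 0 , s≤s z≤n , refl
... | no  _ with count-pos⇒at x xs pos
...   | i , lt , eq = suc i , s≤s lt , eq

at-applyUpTo : ∀ (f : ℕ → ℕ) {m i} → i < m → at (applyUpTo f m) i ≡ f i
at-applyUpTo f {suc m} {zero}  _  = refl
at-applyUpTo f {suc m} {suc i} lt = at-applyUpTo (f ∘ suc) (s≤s⁻¹ lt)

≡take++at∷at∷drop : ∀ xs {t} → suc t < length xs →
  xs ≡ take t xs ++ at xs t ∷ at xs (suc t) ∷ drop (suc (suc t)) xs
≡take++at∷at∷drop (x ∷ [])     {zero}  (s≤s ())
≡take++at∷at∷drop (x ∷ y ∷ xs) {zero}  _  = refl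
≡take++at∷at∷drop (x ∷ xs)     {suc t} lt = cong (x ∷_) (≡take++at∷at∷drop xs (s≤s⁻¹ lt))

takeWhile-applyUpTo : ∀ {P : ℕ → Set} (P? : Decidable P) (f : ℕ → ℕ) m →
  let k = length (takeWhile P? (applyUpTo f m)) in
  (∀ {i} → i < k → P (f i)) × (k < m → ¬ P (f k))
takeWhile-applyUpTo P? f zero = (λ ()) , (λ ())
takeWhile-applyUpTo P? f (suc m) with P? (f 0)
... | yes P₀ with prefix , stop ← takeWhile-applyUpTo P? (f ∘ suc) m =
  (λ { {zero} _ → P₀ ; {suc i} lt → prefix (s≤s⁻¹ lt) }) , (λ lt → stop (s≤s⁻¹ lt))
... | no ¬P₀ = (λ ()) , (λ _ → ¬P₀)

count-applyUpTo-absent : ∀ (f : ℕ → ℕ) m {x} → (∀ {j} → j < m → f j ≢ x) → count x (applyUpTo f m) ≡ 0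
count-applyUpTo-absent f zero    _      = refl
count-applyUpTo-absent f (suc m) absent =
  cong₂ _+_ (δ-≢ (absent (s≤s z≤n) ∘ sym)) (count-applyUpTo-absent (f ∘ suc) m (absent ∘ s≤s))

count-applyUpTo-unique : ∀ (f : ℕ → ℕ) m {x i} → i < m → f i ≡ x → (∀ {j} → j < m → f j ≡ x → j ≡ i) →
  count x (applyUpTo f m) ≡ 1
count-applyUpTo-unique f (suc m) {x} {zero} _ refl unique =
  cong₂ _+_ (δ-refl x) (count-applyUpTo-absent (f ∘ suc) m λ j<m fj≡x → 1+n≢0 (unique (s≤s j<m) fj≡x))
count-applyUpTo-unique f (suc m) {x} {suc i} i<m fi≡x unique =
  cong₂ _+_ (δ-≢ λ x≡f₀ → 1+n≢0 (sym (unique (s≤s z≤n) (sym x≡f₀))))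
            (count-applyUpTo-unique (f ∘ suc) m (s≤s⁻¹ i<m) fi≡x
               λ j<m fj≡x → suc-injective (unique (s≤s j<m) fj≡x))

count≡0⇒All≢ : ∀ {x} xs → count x xs ≡ 0 → All (_≢ x) xs
count≡0⇒All≢         []       _     = []
count≡0⇒All≢ {x} (y ∷ ys) none =
  (λ { refl → 1+n≢0 (trans (cong (_+ count x ys) (sym (δ-refl x))) none) }) ∷
  count≡0⇒All≢ ys (m+n≡0⇒n≡0 (δ x y) none)

count-around : ∀ x xs y z ys → count x (xs ++ y ∷ z ∷ ys) ≡ 1 → x ≡ y ⊎ x ≡ z →
  count x xs ≡ 0 × count x ys ≡ 0
count-around x xs y z ys once (inj₁ refl)
  rewrite count-++ x xs (x ∷ z ∷ ys) | δ-refl x | +-suc (count x xs) (δ x z + count x ys)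
  with none ← suc-injective once
  = m+n≡0⇒m≡0 (count x xs) none , m+n≡0⇒n≡0 (δ x z) (m+n≡0⇒n≡0 (count x xs) none)
count-around x xs y z ys once (inj₂ refl)
  rewrite count-++ x xs (y ∷ x ∷ ys) | δ-refl x | +-suc (δ x y) (count x ys) | +-suc (count x xs) (δ x y + count x ys)
  with none ← suc-injective once
  = m+n≡0⇒m≡0 (count x xs) none , m+n≡0⇒n≡0 (δ x y) (m+n≡0⇒n≡0 (count x xs) none)

-- Interleaving in words with two occurrences of each letter

mutual
  countEven : ℕ → List ℕ → ℕ
  countEven x []       = 0
  countEven x (y ∷ ys) = δ x y + countOdd x ys

  countOdd : ℕ → List ℕ → ℕ
  countOdd x []       = 0
  countOdd x (_ ∷ ys) = countEven x ys

count≡countEven+countOdd : ∀ x xs → count x xs ≡ countEven x xs + countOdd x xs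
count≡countEven+countOdd x []       = refl
count≡countEven+countOdd x (y ∷ ys) = begin
  δ x y + count x ys                       ≡⟨ cong (δ x y +_) (count≡countEven+countOdd x ys) ⟩
  δ x y + (countEven x ys + countOdd x ys) ≡⟨ cong (δ x y +_) (+-comm (countEven x ys) _) ⟩
  δ x y + (countOdd x ys + countEven x ys) ≡⟨ +-assoc (δ x y) _ _ ⟨
  δ x y + countOdd x ys + countEven x ys   ∎
  where open ≡-Reasoning

split-at-first : ∀ x xs {k} → count x xs ≡ suc k →
  ∃ λ pre → ∃ λ post → xs ≡ pre ++ x ∷ post × count x pre ≡ 0 × count x post ≡ k
split-at-first x (y ∷ ys) eq with x ≟ y
... | yes refl = [] , ys , refl , refl , suc-injective eq
... | no  x≢y with split-at-first x ys eq
...   | pre , post , refl , pre₀ , postₖ =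
  y ∷ pre , post , refl , trans (cong (_+ count x pre) (δ-≢ x≢y)) pre₀ , postₖ

gap-even : ∀ x gap rest → count x gap ≡ 0 → countOdd x (gap ++ x ∷ rest) ≡ 0 → 2 ∣ length gap
gap-even x []                rest _ _ = divides 0 refl
gap-even x (y ∷ [])          rest _ odd₀ = ⊥-elim (1+n≢0 (trans (cong (_+ countOdd x rest) (sym (δ-refl x))) odd₀))
gap-even x (y ∷ z ∷ gap) rest gap₀ odd₀
  with divides k eq ← gap-even x gap rest
         (m+n≡0⇒n≡0 (δ x z) (m+n≡0⇒n≡0 (δ x y) gap₀)) (m+n≡0⇒n≡0 (δ x z) odd₀)
  = divides (suc k) (cong (suc ∘ suc) eq)

gap-between-even : ∀ x pre gap post → count x pre ≡ 0 → count x gap ≡ 0 →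
  countEven x (pre ++ x ∷ gap ++ x ∷ post) ≡ 1 → countOdd x (pre ++ x ∷ gap ++ x ∷ post) ≡ 1 →
  2 ∣ length gap
gap-between-even x [] gap post _ gap₀ even₁ _ =
  gap-even x gap post gap₀ (suc-injective (trans (cong (_+ countOdd x (gap ++ x ∷ post)) (sym (δ-refl x))) even₁))
gap-between-even x (y ∷ pre) gap post pre₀ gap₀ even₁ odd₁ =
  gap-between-even x pre gap post (m+n≡0⇒n≡0 (δ x y) pre₀) gap₀ odd₁
    (trans (cong (_+ countOdd x (pre ++ x ∷ gap ++ x ∷ post)) (sym (m+n≡0⇒m≡0 (δ x y) pre₀))) even₁)

at-++-∷-cases : ∀ {x} xs y ys {i} → i < length (xs ++ y ∷ ys) → at (xs ++ y ∷ ys) i ≡ x →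
  (i < length xs × 0 < count x xs) ⊎ (i ≡ length xs × x ≡ y) ⊎
  (∃ λ i′ → i ≡ suc (length xs + i′) × i′ < length ys × at ys i′ ≡ x)
at-++-∷-cases []       y ys {zero}  _  eq = inj₂ (inj₁ (refl , sym eq))
at-++-∷-cases []       y ys {suc i} lt eq = inj₂ (inj₂ (i , refl , s≤s⁻¹ lt , eq))
at-++-∷-cases (z ∷ xs) y ys {zero}  _  eq = inj₁ (s≤s z≤n , at⇒count-pos (z ∷ xs) (s≤s z≤n) eq)
at-++-∷-cases {x} (z ∷ xs) y ys {suc i} lt eq with at-++-∷-cases xs y ys (s≤s⁻¹ lt) eq
... | inj₁ (i< , pos)                = inj₁ (s≤s i< , ≤-trans pos (m≤n+m _ (δ x z)))
... | inj₂ (inj₁ (refl , x≡y))       = inj₂ (inj₁ (refl , x≡y))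
... | inj₂ (inj₂ (i′ , refl , lt′ , eq′)) = inj₂ (inj₂ (i′ , refl , lt′ , eq′))

module _ (x p : ℕ) (pre gap post : List ℕ) where

  private
    A B : ℕ
    A = length pre
    B = suc (length pre + length gap)

  data Region (i : ℕ) : Set where
    in-pre    : i < A → 0 < count x pre → Region i
    at-first  : i ≡ A → x ≡ p → Region i
    in-gap    : A < i → i < B → 0 < count x gap → Region i
    at-second : i ≡ B → x ≡ p → Region i
    in-post   : B < i → 0 < count x post → Region i

  region : ∀ {i} → i < length (pre ++ p ∷ gap ++ p ∷ post) →
           at (pre ++ p ∷ gap ++ p ∷ post) i ≡ x → Region i
  region lt eq with at-++-∷-cases pre p (gap ++ p ∷ post) lt eq
  ... | inj₁ (i<A , pos)        = in-pre i<A pos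
  ... | inj₂ (inj₁ (i≡A , x≡p)) = at-first i≡A x≡p
  ... | inj₂ (inj₂ (i′ , refl , lt′ , eq′)) with at-++-∷-cases gap p post lt′ eq′
  ...   | inj₁ (i′<gap , pos) = in-gap (s≤s (m≤m+n A i′)) (s≤s (+-monoʳ-< A i′<gap)) pos
  ...   | inj₂ (inj₁ (refl , x≡p)) = at-second refl x≡p
  ...   | inj₂ (inj₂ (i″ , refl , lt″ , eq″)) =
    in-post (s≤s (+-monoʳ-< A (s≤s (m≤m+n (length gap) i″)))) (at⇒count-pos post lt″ eq″)

record OrderedAt (w : List ℕ) (p q : ℕ) : Set where
  field
    i j k l : ℕ
    i<j : i < j
    j<k : j < k
    k<l : k < l
    l<∣w∣ : l < length w
    wᵢ : at w i ≡ p
    wⱼ : at w j ≡ q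
    wₖ : at w k ≡ p
    wₗ : at w l ≡ q

  k<∣w∣ : k < length w
  k<∣w∣ = <-trans k<l l<∣w∣

  j<∣w∣ : j < length w
  j<∣w∣ = <-trans j<k k<∣w∣

  i<∣w∣ : i < length w
  i<∣w∣ = <-trans i<j j<∣w∣

Ordered⇒OrderedAt : ∀ {w p q} → Ordered w p q → OrderedAt w p q
Ordered⇒OrderedAt {w} (i , j , k , l , i<j , j<k , k<l , wᵢ , wⱼ , wₖ , wₗ) = record
  { i = toℕ i ; j = toℕ j ; k = toℕ k ; l = toℕ l
  ; i<j = i<j ; j<k = j<k ; k<l = k<l ; l<∣w∣ = toℕ<n l
  ; wᵢ = trans (sym (lookup≡at w i)) wᵢ ; wⱼ = trans (sym (lookup≡at w j)) wⱼ
  ; wₖ = trans (sym (lookup≡at w k)) wₖ ; wₗ = trans (sym (lookup≡at w l)) wₗ }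

OrderedAt⇒Ordered : ∀ {w p q} → OrderedAt w p q → Ordered w p q
OrderedAt⇒Ordered {w} o =
  index i<∣w∣ , index j<∣w∣ , index k<∣w∣ , index l<∣w∣ ,
  monotone i<∣w∣ j<∣w∣ i<j , monotone j<∣w∣ k<∣w∣ j<k , monotone k<∣w∣ l<∣w∣ k<l ,
  entry i<∣w∣ wᵢ , entry j<∣w∣ wⱼ , entry k<∣w∣ wₖ , entry l<∣w∣ wₗ
  where
    open OrderedAt o
    index : ∀ {m} → m < length w → Fin (length w)
    index m< = fromℕ< m<
    monotone : ∀ {m m′} (m< : m < length w) (m′< : m′ < length w) → m < m′ →
               toℕ (index m<) < toℕ (index m′<)
    monotone m< m′< = subst₂ _<_ (sym (toℕ-fromℕ< m<)) (sym (toℕ-fromℕ< m′<))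
    entry : ∀ {m y} (m< : m < length w) → at w m ≡ y → lookup w (index m<) ≡ y
    entry m< eq = trans (lookup≡at w (index m<)) (trans (cong (at w) (toℕ-fromℕ< m<)) eq)

middle≡1 : ∀ a b c → a + (b + c) ≡ 2 → 0 < b → 0 < a ⊎ 0 < c → b ≡ 1
middle≡1 a b c sum≡2 0<b outside = ≤-antisym (s≤s⁻¹ (≤-trans (1+b≤sum outside) (≤-reflexive sum≡2))) 0<b
  where
    1+b≤sum : 0 < a ⊎ 0 < c → suc b ≤ a + (b + c)
    1+b≤sum (inj₁ 0<a) = ≤-trans (+-monoˡ-≤ b 0<a) (+-monoʳ-≤ a (m≤m+n b c))
    1+b≤sum (inj₂ 0<c) = ≤-trans (≤-trans (≤-reflexive (+-comm 1 b)) (+-monoʳ-≤ b 0<c)) (m≤n+m (b + c) a)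

outside-pos : ∀ a c → a + (1 + c) ≡ 2 → 0 < a ⊎ 0 < c
outside-pos zero    c sum≡2 = inj₂ (≤-reflexive (sym (suc-injective sum≡2)))
outside-pos (suc a) c _     = inj₁ (s≤s z≤n)

≤2∧≢1⇒0⊎2 : ∀ {b} → b ≤ 2 → b ≢ 1 → b ≡ 0 ⊎ b ≡ 2
≤2∧≢1⇒0⊎2 {zero}          _ _   = inj₁ refl
≤2∧≢1⇒0⊎2 {suc zero}      _ b≢1 = ⊥-elim (b≢1 refl)
≤2∧≢1⇒0⊎2 {suc (suc zero)} _ _  = inj₂ refl
≤2∧≢1⇒0⊎2 {suc (suc (suc b))} (s≤s (s≤s ())) _

module Interleaving (p q : ℕ) (pre gap post : List ℕ) (q≢p : q ≢ p)
  (pre₀ : count p pre ≡ 0) (gap₀ : count p gap ≡ 0) (post₀ : count p post ≡ 0)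
  (twice : count q (pre ++ p ∷ gap ++ p ∷ post) ≡ 2) where

  private
    w : List ℕ
    w = pre ++ p ∷ gap ++ p ∷ post

    A B : ℕ
    A = length pre
    B = suc (length pre + length gap)

    A<B : A < B
    A<B = s≤s (m≤m+n A (length gap))

  count-split : count q pre + (count q gap + count q post) ≡ 2
  count-split = begin
    count q pre + (count q gap + count q post)
      ≡⟨ cong (λ d → count q pre + (count q gap + (d + count q post))) (δ-≢ q≢p) ⟨
    count q pre + (count q gap + (δ q p + count q post))
      ≡⟨ cong (count q pre +_) (count-++ q gap (p ∷ post)) ⟨
    count q pre + count q (gap ++ p ∷ post)
      ≡⟨ cong (λ d → count q pre + (d + count q (gap ++ p ∷ post))) (δ-≢ q≢p) ⟨
    count q pre + (δ q p + count q (gap ++ p ∷ post))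
      ≡⟨ count-++ q pre (p ∷ gap ++ p ∷ post) ⟨
    count q w
      ≡⟨ twice ⟩
    2 ∎
    where open ≡-Reasoning

  private
    p-position : ∀ {i} → i < length w → at w i ≡ p → i ≡ A ⊎ i ≡ B
    p-position lt eq with region p p pre gap post lt eq
    ... | in-pre _ pos    = ⊥-elim (<⇒≢ pos (sym pre₀))
    ... | at-first i≡A _  = inj₁ i≡A
    ... | in-gap _ _ pos  = ⊥-elim (<⇒≢ pos (sym gap₀))
    ... | at-second i≡B _ = inj₂ i≡B
    ... | in-post _ pos   = ⊥-elim (<⇒≢ pos (sym post₀))

    outer-p-positions : ∀ {i k} → i < k → i < length w → k < length w →
                        at w i ≡ p → at w k ≡ p → i ≡ A × k ≡ B
    outer-p-positions i<k i< k< wᵢ wₖ with p-position i< wᵢ | p-position k< wₖ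
    ... | inj₁ refl | inj₁ refl = ⊥-elim (<-irrefl refl i<k)
    ... | inj₁ i≡A  | inj₂ k≡B  = i≡A , k≡B
    ... | inj₂ refl | inj₁ refl = ⊥-elim (<-asym A<B i<k)
    ... | inj₂ refl | inj₂ refl = ⊥-elim (<-irrefl refl i<k)

    q-in-gap : ∀ {j} → j < length w → at w j ≡ q → A < j → j < B → 0 < count q gap
    q-in-gap lt eq A<j j<B with region q p pre gap post lt eq
    ... | in-pre j<A _    = ⊥-elim (<-asym A<j j<A)
    ... | at-first _ q≡p  = ⊥-elim (q≢p q≡p)
    ... | in-gap _ _ pos  = pos
    ... | at-second _ q≡p = ⊥-elim (q≢p q≡p)
    ... | in-post B<j _   = ⊥-elim (<-asym j<B B<j)

    q-in-pre : ∀ {j} → j < length w → at w j ≡ q → j < A → 0 < count q pre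
    q-in-pre lt eq j<A with region q p pre gap post lt eq
    ... | in-pre _ pos    = pos
    ... | at-first _ q≡p  = ⊥-elim (q≢p q≡p)
    ... | in-gap A<j _ _  = ⊥-elim (<-asym A<j j<A)
    ... | at-second _ q≡p = ⊥-elim (q≢p q≡p)
    ... | in-post B<j _   = ⊥-elim (<-asym (<-trans A<B B<j) j<A)

    q-in-post : ∀ {j} → j < length w → at w j ≡ q → B < j → 0 < count q post
    q-in-post lt eq B<j with region q p pre gap post lt eq
    ... | in-pre j<A _    = ⊥-elim (<-asym (<-trans A<B B<j) j<A)
    ... | at-first _ q≡p  = ⊥-elim (q≢p q≡p)
    ... | in-gap _ j<B _  = ⊥-elim (<-asym j<B B<j)
    ... | at-second _ q≡p = ⊥-elim (q≢p q≡p)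
    ... | in-post _ pos   = pos

  interleaved⇒once : OrderedAt w p q ⊎ OrderedAt w q p → count q gap ≡ 1
  interleaved⇒once (inj₁ o) = middle≡1 (count q pre) _ _ count-split q∈gap (inj₂ q∈post)
    where
      open OrderedAt o
      ends : i ≡ A × k ≡ B
      ends = outer-p-positions (<-trans i<j j<k) i<∣w∣ k<∣w∣ wᵢ wₖ
      q∈gap : 0 < count q gap
      q∈gap = q-in-gap j<∣w∣ wⱼ (subst (_< j) (proj₁ ends) i<j) (subst (j <_) (proj₂ ends) j<k)
      q∈post : 0 < count q post
      q∈post = q-in-post l<∣w∣ wₗ (subst (_< l) (proj₂ ends) k<l)
  interleaved⇒once (inj₂ o) = middle≡1 (count q pre) _ _ count-split q∈gap (inj₁ q∈pre)
    where
      open OrderedAt o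
      ends : j ≡ A × l ≡ B
      ends = outer-p-positions (<-trans j<k k<l) j<∣w∣ l<∣w∣ wⱼ wₗ
      q∈gap : 0 < count q gap
      q∈gap = q-in-gap k<∣w∣ wₖ (subst (_< k) (proj₁ ends) j<k) (subst (k <_) (proj₂ ends) k<l)
      q∈pre : 0 < count q pre
      q∈pre = q-in-pre i<∣w∣ wᵢ (subst (i <_) (proj₁ ends) i<j)

  private
    ∣w∣ : length w ≡ A + suc (length gap + suc (length post))
    ∣w∣ = trans (length-++ pre) (cong (λ n → A + suc n) (length-++ gap))

    first-p : at w A ≡ p
    first-p = at-++-∷ pre p _

    second-p : at w (A + suc (length gap)) ≡ p
    second-p = trans (at-++ʳ pre _ (suc (length gap))) (at-++-∷ gap p post)

    gap-entry : ∀ {g} → g < length gap → at gap g ≡ q → at w (A + suc g) ≡ q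
    gap-entry {g} g< eq = trans (at-++ʳ pre _ (suc g)) (trans (at-++ˡ gap (p ∷ post) g<) eq)

  once⇒interleaved : count q gap ≡ 1 → OrderedAt w p q ⊎ OrderedAt w q p
  once⇒interleaved gap₁ with count-pos⇒at q gap (≤-reflexive (sym gap₁))
  ... | g , g< , gap[g]≡q
    with outside-pos (count q pre) (count q post) (subst (λ c → count q pre + (c + count q post) ≡ 2) gap₁ count-split)
  ... | inj₁ q∈pre with count-pos⇒at q pre q∈pre
  ...   | r , r< , pre[r]≡q = inj₂ (record
          { i = r ; j = A ; k = A + suc g ; l = A + suc (length gap)
          ; i<j = r< ; j<k = m<m+n A (s≤s z≤n) ; k<l = +-monoʳ-< A (s≤s g<)
          ; l<∣w∣ = subst (A + suc (length gap) <_) (sym ∣w∣) (+-monoʳ-< A (s≤s (m<m+n _ (s≤s z≤n))))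
          ; wᵢ = trans (at-++ˡ pre _ r<) pre[r]≡q ; wⱼ = first-p ; wₖ = gap-entry g< gap[g]≡q ; wₗ = second-p })
  once⇒interleaved gap₁ | g , g< , gap[g]≡q | inj₂ q∈post with count-pos⇒at q post q∈post
  ...   | r , r< , post[r]≡q = inj₁ (record
          { i = A ; j = A + suc g ; k = A + suc (length gap) ; l = A + suc (length gap + suc r)
          ; i<j = m<m+n A (s≤s z≤n) ; j<k = +-monoʳ-< A (s≤s g<)
          ; k<l = +-monoʳ-< A (s≤s (m<m+n _ (s≤s z≤n)))
          ; l<∣w∣ = subst (A + suc (length gap + suc r) <_) (sym ∣w∣) (+-monoʳ-< A (s≤s (+-monoʳ-< (length gap) (s≤s r<))))
          ; wᵢ = first-p ; wⱼ = gap-entry g< gap[g]≡q ; wₖ = second-p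
          ; wₗ = trans (at-++ʳ pre _ (suc (length gap + suc r))) (trans (at-++ʳ gap (p ∷ post) (suc r)) post[r]≡q) })

  ¬interleaved⇒0⊎2 : ¬ (OrderedAt w p q ⊎ OrderedAt w q p) → count q gap ≡ 0 ⊎ count q gap ≡ 2
  ¬interleaved⇒0⊎2 ¬interleaved =
    ≤2∧≢1⇒0⊎2 (≤-trans (m≤m+n _ (count q post)) (≤-trans (m≤n+m _ (count q pre)) (≤-reflexive count-split)))
              (¬interleaved ∘ once⇒interleaved)

sum-map-+ : ∀ (f g : ℕ → ℕ) S → sum (map (λ q → f q + g q) S) ≡ sum (map f S) + sum (map g S)
sum-map-+ f g []      = refl
sum-map-+ f g (q ∷ S) =
  trans (cong (f q + g q +_) (sum-map-+ f g S)) (+-interchange (f q) (g q) (sum (map f S)) (sum (map g S)))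

sum-map-δ : ∀ x S → sum (map (λ q → δ q x) S) ≡ count x S
sum-map-δ x []      = refl
sum-map-δ x (q ∷ S) = cong₂ _+_ (δ-sym q x) (sum-map-δ x S)

-- Double counting the pairs (q, position of q in xs).
sum-count≡length : ∀ S xs → All (λ x → count x S ≡ 1) xs → sum (map (λ q → count q xs) S) ≡ length xs
sum-count≡length S []       []             = sum-map-0 S
  where
    sum-map-0 : ∀ S → sum (map (λ _ → 0) S) ≡ 0
    sum-map-0 []      = refl
    sum-map-0 (_ ∷ S) = sum-map-0 S
sum-count≡length S (x ∷ xs) (once ∷ onces) =
  trans (sum-map-+ (λ q → δ q x) (λ q → count q xs) S)
        (cong₂ _+_ (trans (sum-map-δ x S) once) (sum-count≡length S xs onces))

length-filter+even≡sum : ∀ {P : ℕ → Set} (P? : Decidable P) (c : ℕ → ℕ) S →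
  All (λ q → (P q → c q ≡ 1) × (¬ P q → c q ≡ 0 ⊎ c q ≡ 2)) S →
  ∃ λ k → 2 * k + length (filter P? S) ≡ sum (map c S)
length-filter+even≡sum P? c []      []                 = 0 , refl
length-filter+even≡sum P? c (q ∷ S) ((if-P , if-¬P) ∷ cs)
  with k , eq ← length-filter+even≡sum P? c S cs | P? q
... | yes Pq = k , trans (+-suc (2 * k) _) (trans (cong suc eq) (cong (_+ sum (map c S)) (sym (if-P Pq))))
... | no ¬Pq with if-¬P ¬Pq
...   | inj₁ c≡0 = k , trans eq (cong (_+ sum (map c S)) (sym c≡0))
...   | inj₂ c≡2 = suc k , (begin
  2 * suc k + length (filter P? S)   ≡⟨ cong (_+ length (filter P? S)) (*-suc 2 k) ⟩
  2 + 2 * k + length (filter P? S)   ≡⟨ +-assoc 2 (2 * k) _ ⟩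
  2 + (2 * k + length (filter P? S)) ≡⟨ cong (2 +_) eq ⟩
  2 + sum (map c S)                  ≡⟨ cong (_+ sum (map c S)) c≡2 ⟨
  c q + sum (map c S)                ∎)
  where open ≡-Reasoning

count-in-gap : ∀ p pre gap post q → count p pre ≡ 0 → count p gap ≡ 0 → count p post ≡ 0 →
  let w = pre ++ p ∷ gap ++ p ∷ post in count q w ≡ 2 →
  (p ≢ q × (Ordered w p q ⊎ Ordered w q p) → count q gap ≡ 1) ×
  (¬ (p ≢ q × (Ordered w p q ⊎ Ordered w q p)) → count q gap ≡ 0 ⊎ count q gap ≡ 2)
count-in-gap p pre gap post q pre₀ gap₀ post₀ twice with q ≟ p
... | yes refl = (λ (p≢p , _) → ⊥-elim (p≢p refl)) , (λ _ → inj₁ gap₀)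
... | no q≢p =
  (λ (_ , ordered) → interleaved⇒once (⊎-map Ordered⇒OrderedAt Ordered⇒OrderedAt ordered)) ,
  (λ ¬interleaved → ¬interleaved⇒0⊎2 λ ordered →
     ¬interleaved (q≢p ∘ sym , ⊎-map OrderedAt⇒Ordered OrderedAt⇒Ordered ordered))
  where open Interleaving p q pre gap post q≢p pre₀ gap₀ post₀ twice

interleaved-count-even : ∀ (w S : List ℕ) p →
  All (λ x → count x S ≡ 1) w → All (λ q → count q w ≡ 2) S →
  countEven p w ≡ 1 → countOdd p w ≡ 1 →
  (interleaved? : Decidable (λ q → p ≢ q × (Ordered w p q ⊎ Ordered w q p))) →
  2 ∣ length (filter interleaved? S)
interleaved-count-even w S p w-once S-twice even₁ odd₁ interleaved?
  with pre , rest , refl , pre₀ , rest₁ ←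
         split-at-first p w (trans (count≡countEven+countOdd p w) (cong₂ _+_ even₁ odd₁))
  with gap , post , refl , gap₀ , post₀ ← split-at-first p rest rest₁
  with k , sum≡ ← length-filter+even≡sum interleaved? (λ q → count q gap) S
                    (All.map (count-in-gap p pre gap post _ pre₀ gap₀ post₀) S-twice)
  = ∣m+n∣m⇒∣n (subst (2 ∣_) gap≡ (gap-between-even p pre gap post pre₀ gap₀ even₁ odd₁)) (m∣m*n k)
  where
    gap≡ : length gap ≡ 2 * k + length (filter interleaved? S)
    gap≡ = sym (trans sum≡ (sum-count≡length S gap (++⁻ˡ gap (All.tail (++⁻ʳ pre w-once)))))

-- The entries of π and the cycle of C_π through N

module Entries {N : ℕ} (π : Permutation′ N) where

  ent-suc : ∀ {i} (i<N : i < N) → ent π (suc i) ≡ suc (toℕ (π ⟨$⟩ʳ fromℕ< i<N))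
  ent-suc {i} i<N with i <? N
  ... | yes _   = refl
  ... | no  i≮N = ⊥-elim (i≮N i<N)

  ent-out : ∀ {i} → N ≤ i → ent π (suc i) ≡ 0
  ent-out {i} N≤i with i <? N
  ... | yes i<N = ⊥-elim (<⇒≱ i<N N≤i)
  ... | no  _   = refl

  pos-suc : ∀ {v} (v<N : v < N) → pos π (suc v) ≡ suc (toℕ (π ⟨$⟩ˡ fromℕ< v<N))
  pos-suc {v} v<N with v <? N
  ... | yes _   = refl
  ... | no  v≮N = ⊥-elim (v≮N v<N)

  ent≤ : ∀ i → ent π i ≤ N
  ent≤ zero = z≤n
  ent≤ (suc i) with i <? N
  ... | yes _ = toℕ<n _
  ... | no  _ = z≤n

  ent-positive : ∀ {i} → i < N → ∃ λ m → ent π (suc i) ≡ suc m × m < N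
  ent-positive i<N = _ , ent-suc i<N , toℕ<n _

  pos-positive : ∀ {v} → v < N → ∃ λ s → pos π (suc v) ≡ suc s × s < N
  pos-positive v<N = _ , pos-suc v<N , toℕ<n _

  pos-ent : ∀ {i} → i < N → pos π (ent π (suc i)) ≡ suc i
  pos-ent {i} i<N rewrite ent-suc i<N = begin
    pos π (suc (toℕ v))                 ≡⟨ pos-suc (toℕ<n v) ⟩
    suc (toℕ (π ⟨$⟩ˡ fromℕ< (toℕ<n v))) ≡⟨ cong (λ v′ → suc (toℕ (π ⟨$⟩ˡ v′))) (fromℕ<-toℕ v (toℕ<n v)) ⟩
    suc (toℕ (π ⟨$⟩ˡ v))                ≡⟨ cong (suc ∘ toℕ) (inverseˡ π) ⟩
    suc (toℕ (fromℕ< i<N))              ≡⟨ cong suc (toℕ-fromℕ< i<N) ⟩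
    suc i                               ∎
    where
      open ≡-Reasoning
      v : Fin N
      v = π ⟨$⟩ʳ fromℕ< i<N

  ent-pos : ∀ {v} → v < N → ent π (pos π (suc v)) ≡ suc v
  ent-pos {v} v<N rewrite pos-suc v<N = begin
    ent π (suc (toℕ i))                 ≡⟨ ent-suc (toℕ<n i) ⟩
    suc (toℕ (π ⟨$⟩ʳ fromℕ< (toℕ<n i))) ≡⟨ cong (λ i′ → suc (toℕ (π ⟨$⟩ʳ i′))) (fromℕ<-toℕ i (toℕ<n i)) ⟩
    suc (toℕ (π ⟨$⟩ʳ i))                ≡⟨ cong (suc ∘ toℕ) (inverseʳ π) ⟩
    suc (toℕ (fromℕ< v<N))              ≡⟨ cong suc (toℕ-fromℕ< v<N) ⟩
    suc v                               ∎
    where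
      open ≡-Reasoning
      i : Fin N
      i = π ⟨$⟩ˡ fromℕ< v<N

iter-+ : ∀ (f : ℕ → ℕ) m k x → iter f (m + k) x ≡ iter f m (iter f k x)
iter-+ f zero    k x = refl
iter-+ f (suc m) k x = cong f (iter-+ f m k x)

X⁻¹ : ℕ → ℕ → ℕ
X⁻¹ N zero    = N
X⁻¹ N (suc x) = x

X⁻¹-X : ∀ {N x} → x ≤ N → X⁻¹ N (X N x) ≡ x
X⁻¹-X {N} {x} x≤N with x ≟ N
... | yes x≡N = sym x≡N
... | no  _   = refl

X≤ : ∀ {N x} → x ≤ N → X N x ≤ N
X≤ {N} {x} x≤N with x ≟ N
... | yes _   = z≤n
... | no  x≢N = ≤∧≢⇒< x≤N x≢N

X-< : ∀ {N x} → x < N → X N x ≡ suc x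
X-< {N} {x} x<N with x ≟ N
... | yes x≡N = ⊥-elim (<-irrefl x≡N x<N)
... | no  _   = refl

module Cycle {N : ℕ} (π : Permutation′ N) (0<N : 0 < N) where

  open Entries π

  -- Y⁻¹ v is the entry following v in π (0 after the last entry, π(1) after 0).
  Y⁻¹ : ℕ → ℕ
  Y⁻¹ zero    = ent π 1
  Y⁻¹ (suc v) = ent π (suc (pos π (suc v)))

  Y⁻¹-ent : ∀ {i} → i ≤ N → Y⁻¹ (ent π i) ≡ ent π (suc i)
  Y⁻¹-ent {zero}  _   = refl
  Y⁻¹-ent {suc i} i<N with m , entᵢ≡1+m , _ ← ent-positive i<N rewrite entᵢ≡1+m =
    cong (ent π ∘ suc) (trans (cong (pos π) (sym entᵢ≡1+m)) (pos-ent i<N))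

  Y⁻¹-Y : ∀ {x} → x ≤ N → Y⁻¹ (Y π x) ≡ x
  Y⁻¹-Y {zero}  _   = trans (Y⁻¹-ent ≤-refl) (ent-out ≤-refl)
  Y⁻¹-Y {suc v} v<N with s , pos≡1+s , s<N ← pos-positive v<N rewrite pos≡1+s =
    trans (Y⁻¹-ent (<⇒≤ s<N)) (trans (cong (ent π) (sym pos≡1+s)) (ent-pos v<N))

  C≤ : ∀ x → C π x ≤ N
  C≤ x with X N x
  ... | zero  = ent≤ N
  ... | suc v = ent≤ (pos π (suc v) ∸ 1)

  C-injective : ∀ {x y} → x ≤ N → y ≤ N → C π x ≡ C π y → x ≡ y
  C-injective {x} {y} x≤N y≤N Cx≡Cy = begin
    x                      ≡⟨ C⁻¹-C x≤N ⟨
    X⁻¹ N (Y⁻¹ (C π x))    ≡⟨ cong (X⁻¹ N ∘ Y⁻¹) Cx≡Cy ⟩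
    X⁻¹ N (Y⁻¹ (C π y))    ≡⟨ C⁻¹-C y≤N ⟩
    y                      ∎
    where
      open ≡-Reasoning
      C⁻¹-C : ∀ {z} → z ≤ N → X⁻¹ N (Y⁻¹ (C π z)) ≡ z
      C⁻¹-C z≤N = trans (cong (X⁻¹ N) (Y⁻¹-Y (X≤ z≤N))) (X⁻¹-X z≤N)

  C-0 : C π 0 ≡ ent π (pos π 1 ∸ 1)
  C-0 = cong (Y π) (X-< 0<N)

  N-then-1 : C π 0 ≡ N → ∃ λ t → suc t < N × ent π (suc t) ≡ N × ent π (suc (suc t)) ≡ 1
  N-then-1 C₀≡N with pos-positive 0<N
  ... | zero  , pos₁≡1 , _ =
    ⊥-elim (<-irrefl (trans (sym (trans C-0 (cong (λ p → ent π (p ∸ 1)) pos₁≡1))) C₀≡N) 0<N)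
  ... | suc t , pos₁≡2+t , 2+t<N =
    t , 2+t<N , trans (cong (λ p → ent π (p ∸ 1)) (sym pos₁≡2+t)) (trans (sym C-0) C₀≡N) ,
    trans (cong (ent π) (sym pos₁≡2+t)) (ent-pos 0<N)

  orbit : ℕ → ℕ
  orbit k = iter (C π) k N

  orbit≤ : ∀ k → orbit k ≤ N
  orbit≤ zero    = ≤-refl
  orbit≤ (suc k) = C≤ (orbit k)

  orbit-cancel : ∀ i d → orbit i ≡ orbit (i + d) → orbit 0 ≡ orbit d
  orbit-cancel zero    d eq = eq
  orbit-cancel (suc i) d eq = orbit-cancel i d (C-injective (orbit≤ i) (orbit≤ (i + d)) eq)

  private
    SP≡takeWhile : SP π ≡ takeWhile (λ x → ¬? (x ≟ 0)) (applyUpTo (orbit ∘ suc) N)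
    SP≡takeWhile = cong (takeWhile (λ x → ¬? (x ≟ 0))) (map-upTo (orbit ∘ suc) N)

  maximal⇒nonzero : length (SP π) ≡ N ∸ 1 → ∀ {k} → k < N → orbit k ≢ 0
  maximal⇒nonzero _ {zero} _ = <⇒≢ 0<N ∘ sym
  maximal⇒nonzero maximal {suc k} k<N
    with prefix , _ ← takeWhile-applyUpTo (λ x → ¬? (x ≟ 0)) (orbit ∘ suc) N =
    prefix (subst (k <_) (trans (sym maximal) (cong length SP≡takeWhile)) (∸-monoˡ-< {suc k} {1} k<N (s≤s z≤n)))

  maximal⇒orbit-N : length (SP π) ≡ N ∸ 1 → orbit N ≡ 0
  maximal⇒orbit-N maximal
    with _ , stop ← takeWhile-applyUpTo (λ x → ¬? (x ≟ 0)) (orbit ∘ suc) N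
    rewrite sym (cong length SP≡takeWhile) | maximal =
    subst (λ k → orbit k ≡ 0) (m+[n∸m]≡n 0<N) (decidable-stable (_ ≟ 0) (stop (≤-reflexive (m+[n∸m]≡n 0<N))))

  module _ (nonzero : ∀ {k} → k < N → orbit k ≢ 0) (orbit-N : orbit N ≡ 0) where

    orbit-no-early-return : ∀ {d} → 0 < d → d ≤ N → orbit 0 ≢ orbit d
    orbit-no-early-return {d} 0<d d≤N returns = nonzero (∸-monoʳ-< 0<d d≤N) (begin
      orbit (N ∸ d)                    ≡⟨ cong (iter (C π) (N ∸ d)) returns ⟩
      iter (C π) (N ∸ d) (orbit d)     ≡⟨ iter-+ (C π) (N ∸ d) d N ⟨
      orbit (N ∸ d + d)                ≡⟨ cong orbit (m∸n+n≡m d≤N) ⟩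
      orbit N                          ≡⟨ orbit-N ⟩
      0                                ∎)
      where open ≡-Reasoning

    returns-at : ∀ {d} → 0 < d → d ≤ suc N → orbit 0 ≡ orbit d → C π 0 ≡ N
    returns-at {d} 0<d d≤1+N returns with d ≤? N
    ... | yes d≤N = ⊥-elim (orbit-no-early-return 0<d d≤N returns)
    ... | no  d≰N with refl ← ≤-antisym d≤1+N (≰⇒> d≰N) = trans (cong (C π) (sym orbit-N)) (sym returns)

    -- The N + 2 points orbit 0, …, orbit (N + 1) lie in {0, …, N}, and by injectivity of C
    -- a repetition among them is a return to orbit 0.
    C-0≡N : C π 0 ≡ N
    C-0≡N with i , j , i<j , collision ← pigeonhole (n<1+n (suc N)) (λ k → fromℕ< (s≤s (orbit≤ (toℕ k)))) =
      returns-at (m<n⇒0<n∸m i<j) (≤-trans (m∸n≤m (toℕ j) (toℕ i)) (s≤s⁻¹ (toℕ<n j)))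
        (orbit-cancel (toℕ i) _ (trans repeat (cong orbit (sym (m+[n∸m]≡n (<⇒≤ i<j))))))
      where
        repeat : orbit (toℕ i) ≡ orbit (toℕ j)
        repeat = trans (sym (toℕ-fromℕ< _)) (trans (cong toℕ collision) (toℕ-fromℕ< _))

  maximal⇒N-then-1 : length (SP π) ≡ N ∸ 1 → ∃ λ t → suc t < N × ent π (suc t) ≡ N × ent π (suc (suc t)) ≡ 1
  maximal⇒N-then-1 maximal = N-then-1 (C-0≡N (maximal⇒nonzero maximal) (maximal⇒orbit-N maximal))

-- The pointer word W(π)

δ-suc : ∀ x y → δ x y ≡ δ (suc x) (suc y)
δ-suc x y with x ≟ y
... | yes refl = sym (δ-refl (suc x))
... | no  x≢y  = sym (δ-≢ (x≢y ∘ suc-injective))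

pair : ℕ → List ℕ
pair v = v ∸ 1 ∷ v ∷ []

pairs : List ℕ → List ℕ
pairs = concatMap pair

countEven-pairs : ∀ q {xs} → All (0 <_) xs → countEven q (pairs xs) ≡ count (suc q) xs
countEven-pairs q []                    = refl
countEven-pairs q {suc v ∷ _} (_ ∷ pos) = cong₂ _+_ (δ-suc q v) (countEven-pairs q pos)

countOdd-pairs : ∀ q xs → countOdd q (pairs xs) ≡ count q xs
countOdd-pairs q []       = refl
countOdd-pairs q (v ∷ xs) = cong (δ q v +_) (countOdd-pairs q xs)

-- The word pairs (xs ++ a ∷ b ∷ ys) with the two adjacent letters a and b ∸ 1 deleted.
countEven-pairs-around : ∀ q {xs} a b {ys} → All (0 <_) xs → 0 < a → All (0 <_) ys → suc q ≢ b →
  countEven q (pairs xs ++ a ∸ 1 ∷ b ∷ pairs ys) ≡ count (suc q) (xs ++ a ∷ b ∷ ys)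
countEven-pairs-around q (suc a) b [] _ ys-pos 1+q≢b =
  cong₂ _+_ (δ-suc q a) (trans (countEven-pairs q ys-pos) (cong (_+ _) (sym (δ-≢ 1+q≢b))))
countEven-pairs-around q {suc v ∷ _} a b (_ ∷ xs-pos) 0<a ys-pos 1+q≢b =
  cong₂ _+_ (δ-suc q v) (countEven-pairs-around q a b xs-pos 0<a ys-pos 1+q≢b)

countOdd-pairs-around : ∀ q xs a b ys → q ≢ a →
  countOdd q (pairs xs ++ a ∸ 1 ∷ b ∷ pairs ys) ≡ count q (xs ++ a ∷ b ∷ ys)
countOdd-pairs-around q []       a b ys q≢a =
  trans (cong (δ q b +_) (countOdd-pairs q ys)) (cong (_+ _) (sym (δ-≢ q≢a)))
countOdd-pairs-around q (v ∷ xs) a b ys q≢a = cong (δ q v +_) (countOdd-pairs-around q xs a b ys q≢a)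

IsPointer : ℕ → ℕ → Set
IsPointer N x = 0 < x × x < N

-- The entries both of whose pointers survive in W(π).
Interior : ℕ → ℕ → Set
Interior N x = 1 < x × x < N

pairs-pointers : ∀ {N xs} → All (Interior N) xs → All (IsPointer N) (pairs xs)
pairs-pointers []                      = []
pairs-pointers {xs = suc v ∷ _} ((1<x , x<N) ∷ interior) =
  (s≤s⁻¹ 1<x , <-trans (n<1+n v) x<N) ∷ (s≤s z≤n , x<N) ∷ pairs-pointers interior

kept? : ∀ N → Decidable (λ p → ¬ p ≡ 0 × ¬ p ≡ N)
kept? N p = ¬? (p ≟ 0) ×-dec ¬? (p ≟ N)

pointer-kept : ∀ {N x} → IsPointer N x → ¬ x ≡ 0 × ¬ x ≡ N
pointer-kept (0<x , x<N) = <⇒≢ 0<x ∘ sym , <⇒≢ x<N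

filter-pointers : ∀ {N xs} → All (IsPointer N) xs → filter (kept? N) xs ≡ xs
filter-pointers = filter-all (kept? _) ∘ All.map pointer-kept

module PointerWord {N : ℕ} (π : Permutation′ N) (2≤N : 2 ≤ N) {t : ℕ} (2+t<N : suc t < N)
                   (ent-N : ent π (suc t) ≡ N) (ent-1 : ent π (suc (suc t)) ≡ 1) where

  open Entries π

  private
    0<N : 0 < N
    0<N = <-trans (s≤s z≤n) 2≤N

    1<N : 1 < N
    1<N = 2≤N

    N∸1-pointer : IsPointer N (N ∸ 1)
    N∸1-pointer = ∸-monoˡ-< {1} {1} 1<N (s≤s z≤n) , ≤-reflexive (m+[n∸m]≡n 0<N)

    1-pointer : IsPointer N 1
    1-pointer = s≤s z≤n , 1<N

  entries : List ℕ
  entries = applyUpTo (ent π ∘ suc) N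

  before after : List ℕ
  before = take t entries
  after  = drop (suc (suc t)) entries

  entries-split : entries ≡ before ++ N ∷ 1 ∷ after
  entries-split =
    trans (≡take++at∷at∷drop entries (subst (suc t <_) (sym (length-applyUpTo _ N)) 2+t<N))
          (cong₂ (λ x y → before ++ x ∷ y ∷ after)
                 (trans (at-applyUpTo (ent π ∘ suc) (<-trans (n<1+n t) 2+t<N)) ent-N)
                 (trans (at-applyUpTo (ent π ∘ suc) 2+t<N) ent-1))

  count-entries : ∀ {x} → 0 < x → x ≤ N → count x entries ≡ 1
  count-entries {suc v} _ v<N with s , pos≡1+s , s<N ← pos-positive v<N =
    count-applyUpTo-unique (ent π ∘ suc) N s<N (trans (cong (ent π) (sym pos≡1+s)) (ent-pos v<N))
      λ j<N entⱼ≡x → suc-injective (trans (sym (pos-ent j<N)) (trans (cong (pos π) entⱼ≡x) pos≡1+s))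

  private
    InRange : ℕ → Set
    InRange x = 0 < x × x ≤ N

    split-range : All InRange (before ++ N ∷ 1 ∷ after)
    split-range = subst (All InRange) entries-split (applyUpTo⁺₁ (ent π ∘ suc) N in-range)
      where
        in-range : ∀ {i} → i < N → InRange (ent π (suc i))
        in-range i<N with m , ent≡1+m , m<N ← ent-positive i<N = subst InRange (sym ent≡1+m) (s≤s z≤n , m<N)

    once-in-split : ∀ {x} → 0 < x → x ≤ N → count x (before ++ N ∷ 1 ∷ after) ≡ 1
    once-in-split 0<x x≤N = subst (λ xs → count _ xs ≡ 1) entries-split (count-entries 0<x x≤N)

    N-outside : count N before ≡ 0 × count N after ≡ 0
    N-outside = count-around N before N 1 after (once-in-split 0<N ≤-refl) (inj₁ refl)

    1-outside : count 1 before ≡ 0 × count 1 after ≡ 0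
    1-outside = count-around 1 before N 1 after (once-in-split (s≤s z≤n) (<⇒≤ 1<N)) (inj₂ refl)

    interior : ∀ {xs} → All InRange xs → count 1 xs ≡ 0 → count N xs ≡ 0 → All (Interior N) xs
    interior {xs} range no-1 no-N =
      All.zipWith (λ ((0<x , x≤N) , x≢1 , x≢N) → ≤∧≢⇒< 0<x (x≢1 ∘ sym) , ≤∧≢⇒< x≤N x≢N)
                  (range , All.zip (count≡0⇒All≢ xs no-1 , count≡0⇒All≢ xs no-N))

  before-interior : All (Interior N) before
  before-interior = interior (++⁻ˡ before split-range) (proj₁ 1-outside) (proj₁ N-outside)

  after-interior : All (Interior N) after
  after-interior = interior (All.tail (All.tail (++⁻ʳ before split-range))) (proj₂ 1-outside) (proj₂ N-outside)

  W-split : W π ≡ pairs before ++ N ∸ 1 ∷ 1 ∷ pairs after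
  W-split = begin
    W π
      ≡⟨ cong (filter (kept? N)) (concatMap-map pair (ent π ∘ suc) (upTo N)) ⟨
    filter (kept? N) (pairs (map (ent π ∘ suc) (upTo N)))
      ≡⟨ cong (filter (kept? N) ∘ pairs) (trans (map-upTo _ N) entries-split) ⟩
    filter (kept? N) (pairs (before ++ N ∷ 1 ∷ after))
      ≡⟨ cong (filter (kept? N)) (concatMap-++ pair before (N ∷ 1 ∷ after)) ⟩
    filter (kept? N) (pairs before ++ N ∸ 1 ∷ N ∷ 0 ∷ 1 ∷ pairs after)
      ≡⟨ filter-++ (kept? N) (pairs before) _ ⟩
    filter (kept? N) (pairs before) ++ filter (kept? N) (N ∸ 1 ∷ N ∷ 0 ∷ 1 ∷ pairs after)
      ≡⟨ cong₂ _++_ (filter-pointers (pairs-pointers before-interior)) middle ⟩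
    pairs before ++ N ∸ 1 ∷ 1 ∷ pairs after
      ∎
    where
      open ≡-Reasoning
      middle : filter (kept? N) (N ∸ 1 ∷ N ∷ 0 ∷ 1 ∷ pairs after) ≡ N ∸ 1 ∷ 1 ∷ pairs after
      middle = begin
        filter (kept? N) (N ∸ 1 ∷ N ∷ 0 ∷ 1 ∷ pairs after)
          ≡⟨ filter-accept (kept? N) {N ∸ 1} (pointer-kept N∸1-pointer) ⟩
        N ∸ 1 ∷ filter (kept? N) (N ∷ 0 ∷ 1 ∷ pairs after)
          ≡⟨ cong (N ∸ 1 ∷_) (filter-reject (kept? N) {N} (λ (_ , N≢N) → N≢N refl)) ⟩
        N ∸ 1 ∷ filter (kept? N) (0 ∷ 1 ∷ pairs after)
          ≡⟨ cong (N ∸ 1 ∷_) (filter-reject (kept? N) {0} {1 ∷ pairs after} (λ (0≢0 , _) → 0≢0 refl)) ⟩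
        N ∸ 1 ∷ filter (kept? N) (1 ∷ pairs after)
          ≡⟨ cong (N ∸ 1 ∷_) (filter-accept (kept? N) {1} {pairs after} (pointer-kept 1-pointer)) ⟩
        N ∸ 1 ∷ 1 ∷ filter (kept? N) (pairs after)
          ≡⟨ cong (λ xs → N ∸ 1 ∷ 1 ∷ xs) (filter-pointers (pairs-pointers after-interior)) ⟩
        N ∸ 1 ∷ 1 ∷ pairs after
          ∎

  private
    positive : ∀ {xs} → All (Interior N) xs → All (0 <_) xs
    positive = All.map λ (1<x , _) → <-trans (s≤s z≤n) 1<x

  W-countEven : ∀ {q} → IsPointer N q → countEven q (W π) ≡ 1
  W-countEven {q} (0<q , q<N) = begin
    countEven q (W π)                                     ≡⟨ cong (countEven q) W-split ⟩
    countEven q (pairs before ++ N ∸ 1 ∷ 1 ∷ pairs after) ≡⟨ countEven-pairs-around q N 1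
                                                               (positive before-interior) 0<N (positive after-interior)
                                                               (<⇒≢ (s≤s 0<q) ∘ sym) ⟩
    count (suc q) (before ++ N ∷ 1 ∷ after)               ≡⟨ once-in-split (s≤s z≤n) q<N ⟩
    1                                                     ∎
    where open ≡-Reasoning

  W-countOdd : ∀ {q} → IsPointer N q → countOdd q (W π) ≡ 1
  W-countOdd {q} (0<q , q<N) = begin
    countOdd q (W π)                                     ≡⟨ cong (countOdd q) W-split ⟩
    countOdd q (pairs before ++ N ∸ 1 ∷ 1 ∷ pairs after) ≡⟨ countOdd-pairs-around q before N 1 after (<⇒≢ q<N) ⟩
    count q (before ++ N ∷ 1 ∷ after)                    ≡⟨ once-in-split 0<q (<⇒≤ q<N) ⟩
    1                                                    ∎
    where open ≡-Reasoning

  W-count : ∀ {q} → IsPointer N q → count q (W π) ≡ 2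
  W-count {q} q-pointer = trans (count≡countEven+countOdd q (W π)) (cong₂ _+_ (W-countEven q-pointer) (W-countOdd q-pointer))

  W-pointers : All (IsPointer N) (W π)
  W-pointers = subst (All (IsPointer N)) (sym W-split)
    (++⁺ (pairs-pointers before-interior)
         (N∸1-pointer ∷ 1-pointer ∷ pairs-pointers after-interior))

pointersOf : ℕ → List ℕ
pointersOf N = map suc (upTo (N ∸ 1))

pointersOf-IsPointer : ∀ N → All (IsPointer N) (pointersOf N)
pointersOf-IsPointer zero    = subst (All (IsPointer 0)) (sym (map-upTo suc 0)) []
pointersOf-IsPointer (suc N) =
  subst (All (IsPointer (suc N))) (sym (map-upTo suc N)) (applyUpTo⁺₁ suc N λ i<N → s≤s z≤n , s≤s i<N)

count-pointersOf : ∀ N {x} → IsPointer N x → count x (pointersOf N) ≡ 1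
count-pointersOf (suc N) {suc i} (_ , i<N) =
  trans (cong (count (suc i)) (map-upTo suc N))
        (count-applyUpTo-unique suc N (s≤s⁻¹ i<N) refl λ _ → suc-injective)

compatible-count-even : ∀ {N} (π : Permutation′ N) → 2 ≤ N → length (SP π) ≡ N ∸ 1 →
  ∀ {p} → IsPointer N p → 2 ∣ length (filter (compatible? π p) (pointersOf N))
compatible-count-even {N} π 2≤N maximal {p} p-pointer =
  let t , 2+t<N , ent-N , ent-1 = Cycle.maximal⇒N-then-1 π (<-trans (s≤s z≤n) 2≤N) maximal
      open PointerWord π 2≤N 2+t<N ent-N ent-1
  in interleaved-count-even (W π) (pointersOf N) p
       (All.map (count-pointersOf N) W-pointers) (All.map W-count (pointersOf-IsPointer N))
       (W-countEven p-pointer) (W-countOdd p-pointer) (compatible? π p)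

lemma4p12 : (n : ℕ) → 2 ≤ n → (π : Permutation′ (2 * n)) → MaximalSP n π →
            (p : ℕ) → p ∈ contractionPointers n → 2 ∣ numCompatible n π p
lemma4p12 n 2≤n π maximal p p∈ =
  compatible-count-even π (≤-trans 2≤n (m≤m+n n _)) maximal (All.lookup (pointersOf-IsPointer (2 * n)) p∈)
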